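{- For every prime power $q$, there are infinitely many pairs $(F,G)$ of nonzero polynomials in $\mathbb{F}_q[T]$ with $\varphi(F)=\sigma_{nm}(G)$.
   Context: For a nonzero $A\in\mathbb{F}_q[T]$ let $|A|=q^{\deg A}$. For nonzero $F$, $\varphi(F)=\#(\mathbb{F}_q[T]/(F))^*=\prod_{P\mid F}|P|^{v_P(F)-1}(|P|-1)$, the product over monic irreducible $P$ dividing $F$ with $v_P(F)$ the exponent of $P$ in $F$. For nonzero $G$, $\sigma_{nm}(G)=\sum_{D\mid G}|D|$, where the sum runs over all (not necessarily monic) divisors $D$ of $G$ in $\mathbb{F}_q[T]$. -}

module Defs where

open import Data.Nat using (ℕ; _^_; _∸_; _<_)
open import Data.Fin using (Fin)
import Data.Fin as Fin
open import Data.List using (List; []; _∷_; map; length)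
open import Data.Nat.ListAction using (sum)
open import Data.Product using (Σ; ∃; _×_; _,_)
open import Relation.Binary.PropositionalEquality using (_≡_; _≢_)
open import Relation.Nullary using (yes; no)
open import Algebra.Structures using (IsCommutativeRing)
open import Data.List.Membership.Propositional using (_∈_)
open import Data.List.Relation.Unary.Unique.Propositional using (Unique)

record FiniteField (q : ℕ) : Set where
  field
    0# 1#  : Fin q
    _+_ _*_ : Fin q → Fin q → Fin q
    -_     : Fin q → Fin q
    isCommutativeRing : IsCommutativeRing _≡_ _+_ _*_ -_ 0# 1#
    0≢1    : 0# ≢ 1#
    inverse : ∀ x → x ≢ 0# → ∃ λ y → x * y ≡ 1#

module PolyOver {q : ℕ} (K : FiniteField q) where
  open FiniteField K

  -- Polynomials in F_q[T] as coefficient lists, lowest degree first.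
  Poly : Set
  Poly = List (Fin q)

  addP : Poly → Poly → Poly
  addP [] ys = ys
  addP (x ∷ xs) [] = x ∷ xs
  addP (x ∷ xs) (y ∷ ys) = (x + y) ∷ addP xs ys

  negP : Poly → Poly
  negP = map -_

  mulP : Poly → Poly → Poly
  mulP [] ys = []
  mulP (x ∷ xs) ys = addP (map (x *_) ys) (0# ∷ mulP xs ys)

  trim : Poly → Poly
  trim [] = []
  trim (x ∷ xs) with trim xs | x Fin.≟ 0#
  ... | [] | yes _ = []
  ... | [] | no _ = x ∷ []
  ... | (y ∷ ys) | _ = x ∷ y ∷ ys

  -- canonical (normalised) representation: no trailing zeros; [] is the zero polynomial
  Normal : Poly → Set
  Normal p = trim p ≡ p

  -- divisibility in F_q[T] (all divisors, not necessarily monic)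
  _∣ₚ_ : Poly → Poly → Set
  D ∣ₚ G = ∃ λ H → trim (mulP D H) ≡ trim G

  -- degree of a nonzero normalised polynomial, and |A| = q^deg A
  deg : Poly → ℕ
  deg p = length p ∸ 1

  ∣_∣ₚ : Poly → ℕ
  ∣ A ∣ₚ = q ^ deg A

  UnitMod : Poly → Poly → Set
  UnitMod F A = ∃ λ B → F ∣ₚ addP (mulP A B) (negP (1# ∷ []))

  -- φ(F) = m : the units of F_q[T]/(F), with residues represented by the
  -- normalised polynomials of degree < deg F, are exactly m in number.
  PhiIs : Poly → ℕ → Set
  PhiIs F m = Σ (List Poly) λ As →
      Unique As
    × (∀ A → A ∈ As → Normal A × length A < length F × UnitMod F A)
    × (∀ A → Normal A → length A < length F → UnitMod F A → A ∈ As)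
    × length As ≡ m

  SigmaNmIs : Poly → ℕ → Set
  SigmaNmIs G m = Σ (List Poly) λ Ds →
      Unique Ds
    × (∀ D → D ∈ Ds → Normal D × D ∣ₚ G)
    × (∀ D → Normal D → D ∣ₚ G → D ∈ Ds)
    × sum (map ∣_∣ₚ Ds) ≡ m

module Submission where

-- Idea. If P is irreducible of degree d ≥ 1, the units modulo P are exactly the qᵈ − 1
-- nonzero residues, so φ(P) = qᵈ − 1; the divisors of Tᵈ⁻¹ are the monomials c·Tʲ with
-- c ≠ 0 and j < d, so σ_nm(Tᵈ⁻¹) = (q − 1)(1 + q + ⋯ + qᵈ⁻¹) = qᵈ − 1 as well. To avoid L,
-- take P an irreducible factor of 1 + T·∏F, the product over the nonzero first components
-- F of L: as in Euclid's proof, P divides no such F.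

open import Defs
open import Data.Nat as ℕ using (ℕ; zero; suc; _≤_; _<_; z≤n; s≤s; _∸_; _^_)
import Data.Nat.Properties as ℕ
open import Data.Nat.ListAction using (sum)
open import Data.Nat.ListAction.Properties using (sum-++)
open import Data.Fin as Fin using (Fin)
import Data.Fin.Properties as FinP
open import Data.List using (List; []; _∷_; map; length; _++_; tabulate; allFin; cartesianProductWith)
open import Data.List.Properties using (length-tabulate; length-map; length-++; map-++; ∷-injective)
open import Data.List.Membership.Propositional using (_∈_; _∉_)
open import Data.List.Membership.Propositional.Properties
  using (∈-tabulate⁺; ∈-tabulate⁻; ∈-allFin; ∈-map⁺; ∈-map⁻; ∈-++⁺ˡ; ∈-++⁺ʳ; ∈-++⁻;
         ∈-cartesianProductWith⁺; ∈-cartesianProductWith⁻)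
open import Data.List.Relation.Unary.Any using (here; there)
open import Data.List.Relation.Unary.AllPairs using ([])
open import Data.List.Relation.Unary.Unique.Propositional using (Unique)
import Data.List.Relation.Unary.Unique.Propositional.Properties as UniqueP
open import Data.Product using (∃; ∃₂; _×_; _,_; proj₁; proj₂)
open import Data.Sum using (_⊎_; inj₁; inj₂)
open import Data.Empty using (⊥-elim)
open import Function using (case_of_)
open import Relation.Nullary using (¬_; Dec; yes; no)
open import Relation.Binary.PropositionalEquality
  using (_≡_; _≢_; refl; sym; trans; cong; cong₂; subst; subst₂; module ≡-Reasoning)
open import Relation.Binary.Bundles using (Setoid)
import Relation.Binary.Reasoning.Setoid as SetoidReasoning
open import Algebra.Structures using (IsCommutativeRing)
open import Algebra.Bundles using (CommutativeRing)
import Algebra.Properties.Group as GroupProperties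
import Algebra.Properties.CommutativeSemigroup as CommSemigroupProperties
import Algebra.Properties.Ring as RingProperties
import Algebra.Properties.Monoid.Divisibility as DivisibilityProperties

-- (b − 1) + b·(bⁿ − 1) = bⁿ⁺¹ − 1: the recurrence satisfied by both counts below.
geometric-step : ∀ b n .{{_ : ℕ.NonZero b}} → (b ∸ 1) ℕ.+ b ℕ.* (b ^ n ∸ 1) ≡ b ^ suc n ∸ 1
geometric-step b n = begin
    (b ∸ 1) ℕ.+ b ℕ.* (b ^ n ∸ 1)
      ≡⟨ cong ((b ∸ 1) ℕ.+_) (trans (ℕ.*-distribˡ-∸ b (b ^ n) 1) (cong (b ^ suc n ∸_) (ℕ.*-identityʳ b))) ⟩
    (b ∸ 1) ℕ.+ (b ^ suc n ∸ b)     ≡⟨ ℕ.+-comm (b ∸ 1) _ ⟩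
    (b ^ suc n ∸ b) ℕ.+ (b ∸ 1)     ≡⟨ sym (ℕ.+-∸-assoc _ (ℕ.>-nonZero⁻¹ b)) ⟩
    (b ^ suc n ∸ b) ℕ.+ b ∸ 1       ≡⟨ cong (_∸ 1) (ℕ.m∸n+n≡m (ℕ.m≤m*n b (b ^ n) {{ℕ.m^n≢0 b n}})) ⟩
    b ^ suc n ∸ 1                   ∎
  where open ≡-Reasoning

allExcept : ∀ {n} → Fin n → List (Fin n)
allExcept {suc n} i = tabulate (Fin.punchIn i)

allExcept-length : ∀ {n} (i : Fin n) → length (allExcept i) ≡ n ∸ 1
allExcept-length {suc n} i = length-tabulate (Fin.punchIn i)

∈-allExcept⁺ : ∀ {n} {i j : Fin n} → j ≢ i → j ∈ allExcept i
∈-allExcept⁺ {suc n} {i} j≢i =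
  subst (_∈ allExcept i) (FinP.punchIn-punchOut (λ i≡j → j≢i (sym i≡j))) (∈-tabulate⁺ _)

∈-allExcept⁻ : ∀ {n} {i j : Fin n} → j ∈ allExcept i → j ≢ i
∈-allExcept⁻ {suc n} {i} j∈ with ∈-tabulate⁻ j∈
... | k , refl = FinP.punchInᵢ≢i i k

allExcept-unique : ∀ {n} (i : Fin n) → Unique (allExcept i)
allExcept-unique {suc n} i = UniqueP.tabulate⁺ (FinP.punchIn-injective i _ _)

length-cartesianProductWith : ∀ {A B C : Set} (f : A → B → C) (xs : List A) (ys : List B) →
  length (cartesianProductWith f xs ys) ≡ length xs ℕ.* length ys
length-cartesianProductWith f [] ys = refl
length-cartesianProductWith f (x ∷ xs) ys =
  trans (length-++ (map (f x) ys))
        (cong₂ ℕ._+_ (length-map (f x) ys) (length-cartesianProductWith f xs ys))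

all-or-exception : ∀ {A Y : Set} {X : A → Set} (xs : List A) →
  (∀ {x} → x ∈ xs → X x ⊎ Y) → (∀ {x} → x ∈ xs → X x) ⊎ Y
all-or-exception [] _ = inj₁ λ ()
all-or-exception (x ∷ xs) decide with decide (here refl) | all-or-exception xs (λ x∈ → decide (there x∈))
... | inj₂ y | _ = inj₂ y
... | inj₁ _ | inj₂ y = inj₂ y
... | inj₁ X-x | inj₁ X-xs = inj₁ λ { (here refl) → X-x ; (there x∈) → X-xs x∈ }

module Proof {q : ℕ} (K : FiniteField q) where
  open FiniteField K
  open IsCommutativeRing isCommutativeRing
    using (+-assoc; +-comm; +-identityˡ; +-identityʳ; -‿inverseˡ; -‿inverseʳ;
           *-assoc; *-comm; *-identityˡ; *-identityʳ; distribˡ; distribʳ; zeroˡ; zeroʳ)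
  open PolyOver K
    renaming (addP to infixl 6 _+ₚ_; mulP to infixl 7 _*ₚ_; negP to -ₚ_)

  instance
    q-nonZero : ℕ.NonZero q
    q-nonZero = FinP.nonZeroIndex 0#

  field-CR : CommutativeRing _ _
  field-CR = record { isCommutativeRing = isCommutativeRing }

  open GroupProperties (CommutativeRing.+-group field-CR) using (ε⁻¹≈ε; ⁻¹-injective)
  open CommSemigroupProperties (CommutativeRing.+-commutativeSemigroup field-CR)
    using (interchange)

  no-zero-divisors : ∀ x y → x * y ≡ 0# → x ≡ 0# ⊎ y ≡ 0#
  no-zero-divisors x y xy≡0 with x Fin.≟ 0#
  ... | yes x≡0 = inj₁ x≡0
  ... | no x≢0 with inverse x x≢0
  ... | (x⁻¹ , xx⁻¹≡1) = inj₂ (begin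
      y               ≡⟨ sym (*-identityˡ y) ⟩
      1# * y          ≡⟨ cong (_* y) (trans (sym xx⁻¹≡1) (*-comm x x⁻¹)) ⟩
      (x⁻¹ * x) * y   ≡⟨ *-assoc x⁻¹ x y ⟩
      x⁻¹ * (x * y)   ≡⟨ cong (x⁻¹ *_) xy≡0 ⟩
      x⁻¹ * 0#        ≡⟨ zeroʳ x⁻¹ ⟩
      0#              ∎)
    where open ≡-Reasoning

  -- Coefficients; a list is implicitly padded with zeros.
  coeff : Poly → ℕ → Fin q
  coeff [] k = 0#
  coeff (x ∷ xs) zero = x
  coeff (x ∷ xs) (suc k) = coeff xs k

  -- Equality of polynomials: equality of all coefficients (trailing zeros are invisible).
  infix 4 _≈_
  record _≈_ (a b : Poly) : Set where
    constructor coeffwise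
    field at : ∀ k → coeff a k ≡ coeff b k
  open _≈_ public

  ≈-refl : ∀ {a} → a ≈ a
  ≈-refl = coeffwise λ _ → refl

  ≈-sym : ∀ {a b} → a ≈ b → b ≈ a
  ≈-sym a≈b = coeffwise λ k → sym (at a≈b k)

  ≈-trans : ∀ {a b c} → a ≈ b → b ≈ c → a ≈ c
  ≈-trans a≈b b≈c = coeffwise λ k → trans (at a≈b k) (at b≈c k)

  ≈-reflexive : ∀ {a b} → a ≡ b → a ≈ b
  ≈-reflexive refl = ≈-refl

  ≈-setoid : Setoid _ _
  ≈-setoid = record
    { Carrier = Poly ; _≈_ = _≈_
    ; isEquivalence = record { refl = ≈-refl ; sym = ≈-sym ; trans = ≈-trans } }

  ∷-cong : ∀ {x y a b} → x ≡ y → a ≈ b → x ∷ a ≈ y ∷ b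
  ∷-cong x≡y a≈b = coeffwise λ { zero → x≡y ; (suc k) → at a≈b k }

  ∷-tail : ∀ {x y a b} → x ∷ a ≈ y ∷ b → a ≈ b
  ∷-tail e = coeffwise λ k → at e (suc k)

  zero∷ : ∀ {x a} → x ≡ 0# → a ≈ [] → x ∷ a ≈ []
  zero∷ x≡0 a≈0 = coeffwise λ { zero → x≡0 ; (suc k) → at a≈0 k }

  zero∷-tail : ∀ {x a} → x ∷ a ≈ [] → a ≈ []
  zero∷-tail e = coeffwise λ k → at e (suc k)

  coeff-trim : ∀ a k → coeff (trim a) k ≡ coeff a k
  coeff-trim [] k = refl
  coeff-trim (x ∷ xs) k with trim xs | x Fin.≟ 0# | coeff-trim xs
  coeff-trim (x ∷ xs) zero    | [] | yes x≡0 | _ = sym x≡0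
  coeff-trim (x ∷ xs) (suc k) | [] | yes _   | ih = ih k
  coeff-trim (x ∷ xs) zero    | [] | no _    | _ = refl
  coeff-trim (x ∷ xs) (suc k) | [] | no _    | ih = ih k
  coeff-trim (x ∷ xs) zero    | _ ∷ _ | _ | _ = refl
  coeff-trim (x ∷ xs) (suc k) | _ ∷ _ | _ | ih = ih k

  trim≈ : ∀ a → trim a ≈ a
  trim≈ a = coeffwise (coeff-trim a)

  trim-zero : ∀ a → a ≈ [] → trim a ≡ []
  trim-zero [] _ = refl
  trim-zero (x ∷ xs) e with trim xs | x Fin.≟ 0# | trim-zero xs (zero∷-tail e)
  ... | [] | yes _ | _ = refl
  ... | [] | no x≢0 | _ = ⊥-elim (x≢0 (at e 0))

  ≈⇒trim≡ : ∀ a b → a ≈ b → trim a ≡ trim b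
  ≈⇒trim≡ [] b e = sym (trim-zero b (≈-sym e))
  ≈⇒trim≡ (x ∷ xs) [] e = trim-zero (x ∷ xs) e
  ≈⇒trim≡ (x ∷ xs) (y ∷ ys) e with at e 0
  ... | refl with trim xs | trim ys | ≈⇒trim≡ xs ys (∷-tail e)
  ... | t | .t | refl = refl

  trim≡⇒≈ : ∀ {a b} → trim a ≡ trim b → a ≈ b
  trim≡⇒≈ {a} {b} e = ≈-trans (≈-sym (trim≈ a)) (subst (_≈ b) (sym e) (trim≈ b))

  trim-normal : ∀ a → Normal (trim a)
  trim-normal a = ≈⇒trim≡ (trim a) a (trim≈ a)

  scale : Fin q → Poly → Poly
  scale c a = map (c *_) a

  shift : Poly → Poly
  shift a = 0# ∷ a

  1ₚ : Poly
  1ₚ = 1# ∷ []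

  coeff-+ : ∀ a b k → coeff (a +ₚ b) k ≡ coeff a k + coeff b k
  coeff-+ [] b k = sym (+-identityˡ _)
  coeff-+ (x ∷ xs) [] k = sym (+-identityʳ _)
  coeff-+ (x ∷ xs) (y ∷ ys) zero = refl
  coeff-+ (x ∷ xs) (y ∷ ys) (suc k) = coeff-+ xs ys k

  coeff-neg : ∀ a k → coeff (-ₚ a) k ≡ - coeff a k
  coeff-neg [] k = sym ε⁻¹≈ε
  coeff-neg (x ∷ xs) zero = refl
  coeff-neg (x ∷ xs) (suc k) = coeff-neg xs k

  coeff-scale : ∀ c a k → coeff (scale c a) k ≡ c * coeff a k
  coeff-scale c [] k = sym (zeroʳ c)
  coeff-scale c (y ∷ ys) zero = refl
  coeff-scale c (y ∷ ys) (suc k) = coeff-scale c ys k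

  +ₚ-cong : ∀ {a a' b b'} → a ≈ a' → b ≈ b' → a +ₚ b ≈ a' +ₚ b'
  +ₚ-cong {a} {a'} {b} {b'} a≈a' b≈b' = coeffwise λ k → begin
      coeff (a +ₚ b) k          ≡⟨ coeff-+ a b k ⟩
      coeff a k + coeff b k     ≡⟨ cong₂ _+_ (at a≈a' k) (at b≈b' k) ⟩
      coeff a' k + coeff b' k   ≡⟨ sym (coeff-+ a' b' k) ⟩
      coeff (a' +ₚ b') k        ∎
    where open ≡-Reasoning

  +ₚ-comm : ∀ a b → a +ₚ b ≈ b +ₚ a
  +ₚ-comm a b = coeffwise λ k →
    trans (coeff-+ a b k) (trans (+-comm _ _) (sym (coeff-+ b a k)))

  +ₚ-assoc : ∀ a b c → (a +ₚ b) +ₚ c ≈ a +ₚ (b +ₚ c)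
  +ₚ-assoc a b c = coeffwise λ k → begin
      coeff ((a +ₚ b) +ₚ c) k                ≡⟨ trans (coeff-+ (a +ₚ b) c k) (cong (_+ _) (coeff-+ a b k)) ⟩
      (coeff a k + coeff b k) + coeff c k    ≡⟨ +-assoc _ _ _ ⟩
      coeff a k + (coeff b k + coeff c k)    ≡⟨ sym (trans (coeff-+ a (b +ₚ c) k) (cong (_ +_) (coeff-+ b c k))) ⟩
      coeff (a +ₚ (b +ₚ c)) k                ∎
    where open ≡-Reasoning

  +ₚ-interchange : ∀ a b c d → (a +ₚ b) +ₚ (c +ₚ d) ≈ (a +ₚ c) +ₚ (b +ₚ d)
  +ₚ-interchange a b c d = coeffwise λ k → begin
      coeff ((a +ₚ b) +ₚ (c +ₚ d)) k
        ≡⟨ trans (coeff-+ (a +ₚ b) (c +ₚ d) k) (cong₂ _+_ (coeff-+ a b k) (coeff-+ c d k)) ⟩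
      (coeff a k + coeff b k) + (coeff c k + coeff d k)
        ≡⟨ interchange _ _ _ _ ⟩
      (coeff a k + coeff c k) + (coeff b k + coeff d k)
        ≡⟨ sym (trans (coeff-+ (a +ₚ c) (b +ₚ d) k) (cong₂ _+_ (coeff-+ a c k) (coeff-+ b d k))) ⟩
      coeff ((a +ₚ c) +ₚ (b +ₚ d)) k ∎
    where open ≡-Reasoning

  +ₚ-identityʳ : ∀ a → a +ₚ [] ≈ a
  +ₚ-identityʳ a = coeffwise λ k → trans (coeff-+ a [] k) (+-identityʳ _)

  -ₚ-inverseˡ : ∀ a → -ₚ a +ₚ a ≈ []
  -ₚ-inverseˡ a = coeffwise λ k →
    trans (coeff-+ (-ₚ a) a k) (trans (cong (_+ coeff a k) (coeff-neg a k)) (-‿inverseˡ _))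

  -ₚ-inverseʳ : ∀ a → a +ₚ -ₚ a ≈ []
  -ₚ-inverseʳ a = ≈-trans (+ₚ-comm a (-ₚ a)) (-ₚ-inverseˡ a)

  -ₚ-cong : ∀ {a b} → a ≈ b → -ₚ a ≈ -ₚ b
  -ₚ-cong {a} {b} a≈b = coeffwise λ k →
    trans (coeff-neg a k) (trans (cong -_ (at a≈b k)) (sym (coeff-neg b k)))

  scale-cong : ∀ c {a b} → a ≈ b → scale c a ≈ scale c b
  scale-cong c {a} {b} a≈b = coeffwise λ k →
    trans (coeff-scale c a k) (trans (cong (c *_) (at a≈b k)) (sym (coeff-scale c b k)))

  scale-zero : ∀ {c} a → c ≡ 0# → scale c a ≈ []
  scale-zero {c} a c≡0 = coeffwise λ k →
    trans (coeff-scale c a k) (trans (cong (_* coeff a k) c≡0) (zeroˡ _))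

  scale-one : ∀ a → scale 1# a ≈ a
  scale-one a = coeffwise λ k → trans (coeff-scale 1# a k) (*-identityˡ _)

  scale-+ₚ : ∀ c a b → scale c (a +ₚ b) ≈ scale c a +ₚ scale c b
  scale-+ₚ c a b = coeffwise λ k → begin
      coeff (scale c (a +ₚ b)) k              ≡⟨ trans (coeff-scale c (a +ₚ b) k) (cong (c *_) (coeff-+ a b k)) ⟩
      c * (coeff a k + coeff b k)             ≡⟨ distribˡ c _ _ ⟩
      (c * coeff a k) + (c * coeff b k)       ≡⟨ sym (cong₂ _+_ (coeff-scale c a k) (coeff-scale c b k)) ⟩
      coeff (scale c a) k + coeff (scale c b) k ≡⟨ sym (coeff-+ (scale c a) (scale c b) k) ⟩
      coeff (scale c a +ₚ scale c b) k        ∎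
    where open ≡-Reasoning

  scale-* : ∀ c d a → scale (c * d) a ≈ scale c (scale d a)
  scale-* c d a = coeffwise λ k → begin
      coeff (scale (c * d) a) k   ≡⟨ trans (coeff-scale (c * d) a k) (*-assoc c d _) ⟩
      c * (d * coeff a k)         ≡⟨ sym (trans (coeff-scale c (scale d a) k) (cong (c *_) (coeff-scale d a k))) ⟩
      coeff (scale c (scale d a)) k ∎
    where open ≡-Reasoning

  shift-cong : ∀ {a b} → a ≈ b → shift a ≈ shift b
  shift-cong = ∷-cong refl

  shift-zero : shift [] ≈ []
  shift-zero = zero∷ refl ≈-refl

  shift-+ₚ : ∀ a b → shift a +ₚ shift b ≈ shift (a +ₚ b)
  shift-+ₚ a b = ∷-cong (+-identityˡ 0#) ≈-refl

  scale-shift : ∀ c a → scale c (shift a) ≈ shift (scale c a)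
  scale-shift c a = ∷-cong (zeroʳ c) ≈-refl

  ∷-as-sum : ∀ x a → x ∷ a ≈ (x ∷ []) +ₚ shift a
  ∷-as-sum x a = ∷-cong (sym (+-identityʳ x)) ≈-refl

  *ₚ-congʳ : ∀ a {b b'} → b ≈ b' → a *ₚ b ≈ a *ₚ b'
  *ₚ-congʳ [] _ = ≈-refl
  *ₚ-congʳ (x ∷ xs) b≈b' = +ₚ-cong (scale-cong x b≈b') (shift-cong (*ₚ-congʳ xs b≈b'))

  zero-*ₚ : ∀ {a} b → a ≈ [] → a *ₚ b ≈ []
  zero-*ₚ {[]} b _ = ≈-refl
  zero-*ₚ {x ∷ xs} b a≈0 =
    ≈-trans (+ₚ-cong (scale-zero b (at a≈0 0)) (shift-cong (zero-*ₚ b (zero∷-tail a≈0)))) shift-zero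

  *ₚ-congˡ : ∀ {a a'} b → a ≈ a' → a *ₚ b ≈ a' *ₚ b
  *ₚ-congˡ {[]} b a≈a' = ≈-sym (zero-*ₚ b (≈-sym a≈a'))
  *ₚ-congˡ {x ∷ xs} {[]} b a≈a' = zero-*ₚ b a≈a'
  *ₚ-congˡ {x ∷ xs} {y ∷ ys} b a≈a' =
    +ₚ-cong (≈-reflexive (cong (λ z → scale z b) (at a≈a' 0))) (shift-cong (*ₚ-congˡ b (∷-tail a≈a')))

  *ₚ-cong : ∀ {a a' b b'} → a ≈ a' → b ≈ b' → a *ₚ b ≈ a' *ₚ b'
  *ₚ-cong {a' = a'} {b = b} a≈a' b≈b' = ≈-trans (*ₚ-congˡ b a≈a') (*ₚ-congʳ a' b≈b')

  *ₚ-distribˡ : ∀ a b c → a *ₚ (b +ₚ c) ≈ a *ₚ b +ₚ a *ₚ c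
  *ₚ-distribˡ [] b c = ≈-refl
  *ₚ-distribˡ (x ∷ xs) b c = begin
      scale x (b +ₚ c) +ₚ shift (xs *ₚ (b +ₚ c))
        ≈⟨ +ₚ-cong (scale-+ₚ x b c) (shift-cong (*ₚ-distribˡ xs b c)) ⟩
      (scale x b +ₚ scale x c) +ₚ shift (xs *ₚ b +ₚ xs *ₚ c)
        ≈⟨ +ₚ-cong ≈-refl (≈-sym (shift-+ₚ (xs *ₚ b) (xs *ₚ c))) ⟩
      (scale x b +ₚ scale x c) +ₚ (shift (xs *ₚ b) +ₚ shift (xs *ₚ c))
        ≈⟨ +ₚ-interchange (scale x b) (scale x c) (shift (xs *ₚ b)) (shift (xs *ₚ c)) ⟩
      (x ∷ xs) *ₚ b +ₚ (x ∷ xs) *ₚ c ∎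
    where open SetoidReasoning ≈-setoid

  shift-*ₚ : ∀ a b → shift a *ₚ b ≈ shift (a *ₚ b)
  shift-*ₚ a b = +ₚ-cong (scale-zero b refl) ≈-refl

  *ₚ-shift : ∀ a b → a *ₚ shift b ≈ shift (a *ₚ b)
  *ₚ-shift [] b = ≈-sym shift-zero
  *ₚ-shift (x ∷ xs) b = begin
      scale x (shift b) +ₚ shift (xs *ₚ shift b)
        ≈⟨ +ₚ-cong (scale-shift x b) (shift-cong (*ₚ-shift xs b)) ⟩
      shift (scale x b) +ₚ shift (shift (xs *ₚ b))
        ≈⟨ shift-+ₚ (scale x b) (shift (xs *ₚ b)) ⟩
      shift ((x ∷ xs) *ₚ b) ∎
    where open SetoidReasoning ≈-setoid

  const-*ₚ : ∀ c a → (c ∷ []) *ₚ a ≈ scale c a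
  const-*ₚ c a = ≈-trans (+ₚ-cong ≈-refl shift-zero) (+ₚ-identityʳ _)

  *ₚ-const : ∀ a c → a *ₚ (c ∷ []) ≈ scale c a
  *ₚ-const [] c = ≈-refl
  *ₚ-const (x ∷ xs) c = ∷-cong (trans (+-identityʳ _) (*-comm x c)) (*ₚ-const xs c)

  *ₚ-zero : ∀ a → a *ₚ [] ≈ []
  *ₚ-zero [] = ≈-refl
  *ₚ-zero (x ∷ xs) = ≈-trans (shift-cong (*ₚ-zero xs)) shift-zero

  *ₚ-comm : ∀ a b → a *ₚ b ≈ b *ₚ a
  *ₚ-comm [] b = ≈-sym (*ₚ-zero b)
  *ₚ-comm (x ∷ xs) b = begin
      scale x b +ₚ shift (xs *ₚ b)      ≈⟨ +ₚ-cong (≈-sym (*ₚ-const b x)) (shift-cong (*ₚ-comm xs b)) ⟩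
      b *ₚ (x ∷ []) +ₚ shift (b *ₚ xs)  ≈⟨ +ₚ-cong ≈-refl (≈-sym (*ₚ-shift b xs)) ⟩
      b *ₚ (x ∷ []) +ₚ b *ₚ shift xs    ≈⟨ ≈-sym (*ₚ-distribˡ b (x ∷ []) (shift xs)) ⟩
      b *ₚ ((x ∷ []) +ₚ shift xs)       ≈⟨ *ₚ-congʳ b (≈-sym (∷-as-sum x xs)) ⟩
      b *ₚ (x ∷ xs)                     ∎
    where open SetoidReasoning ≈-setoid

  *ₚ-distribʳ : ∀ a b c → (a +ₚ b) *ₚ c ≈ a *ₚ c +ₚ b *ₚ c
  *ₚ-distribʳ a b c = begin
      (a +ₚ b) *ₚ c        ≈⟨ *ₚ-comm (a +ₚ b) c ⟩
      c *ₚ (a +ₚ b)        ≈⟨ *ₚ-distribˡ c a b ⟩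
      c *ₚ a +ₚ c *ₚ b     ≈⟨ +ₚ-cong (*ₚ-comm c a) (*ₚ-comm c b) ⟩
      a *ₚ c +ₚ b *ₚ c     ∎
    where open SetoidReasoning ≈-setoid

  scale-*ₚ : ∀ c a b → scale c a *ₚ b ≈ scale c (a *ₚ b)
  scale-*ₚ c [] b = ≈-refl
  scale-*ₚ c (y ∷ ys) b = begin
      scale (c * y) b +ₚ shift (scale c ys *ₚ b)
        ≈⟨ +ₚ-cong (scale-* c y b) (shift-cong (scale-*ₚ c ys b)) ⟩
      scale c (scale y b) +ₚ shift (scale c (ys *ₚ b))
        ≈⟨ +ₚ-cong ≈-refl (≈-sym (scale-shift c (ys *ₚ b))) ⟩
      scale c (scale y b) +ₚ scale c (shift (ys *ₚ b))
        ≈⟨ ≈-sym (scale-+ₚ c (scale y b) (shift (ys *ₚ b))) ⟩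
      scale c ((y ∷ ys) *ₚ b) ∎
    where open SetoidReasoning ≈-setoid

  *ₚ-assoc : ∀ a b c → (a *ₚ b) *ₚ c ≈ a *ₚ (b *ₚ c)
  *ₚ-assoc [] b c = ≈-refl
  *ₚ-assoc (x ∷ xs) b c = begin
      (scale x b +ₚ shift (xs *ₚ b)) *ₚ c
        ≈⟨ *ₚ-distribʳ (scale x b) (shift (xs *ₚ b)) c ⟩
      scale x b *ₚ c +ₚ shift (xs *ₚ b) *ₚ c
        ≈⟨ +ₚ-cong (scale-*ₚ x b c) (shift-*ₚ (xs *ₚ b) c) ⟩
      scale x (b *ₚ c) +ₚ shift ((xs *ₚ b) *ₚ c)
        ≈⟨ +ₚ-cong ≈-refl (shift-cong (*ₚ-assoc xs b c)) ⟩
      (x ∷ xs) *ₚ (b *ₚ c) ∎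
    where open SetoidReasoning ≈-setoid

  *ₚ-identityˡ : ∀ a → 1ₚ *ₚ a ≈ a
  *ₚ-identityˡ a = ≈-trans (const-*ₚ 1# a) (scale-one a)

  *ₚ-identityʳ : ∀ a → a *ₚ 1ₚ ≈ a
  *ₚ-identityʳ a = ≈-trans (*ₚ-comm a 1ₚ) (*ₚ-identityˡ a)

  poly-CR : CommutativeRing _ _
  poly-CR = record
    { Carrier = Poly ; _≈_ = _≈_ ; _+_ = _+ₚ_ ; _*_ = _*ₚ_ ; -_ = -ₚ_ ; 0# = [] ; 1# = 1ₚ
    ; isCommutativeRing = record
      { isRing = record
        { +-isAbelianGroup = record
          { isGroup = record
            { isMonoid = record
              { isSemigroup = record
                { isMagma = record { isEquivalence = Setoid.isEquivalence ≈-setoid ; ∙-cong = +ₚ-cong }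
                ; assoc = +ₚ-assoc }
              ; identity = (λ _ → ≈-refl) , +ₚ-identityʳ }
            ; inverse = -ₚ-inverseˡ , -ₚ-inverseʳ
            ; ⁻¹-cong = -ₚ-cong }
          ; comm = +ₚ-comm }
        ; *-cong = *ₚ-cong
        ; *-assoc = *ₚ-assoc
        ; *-identity = *ₚ-identityˡ , *ₚ-identityʳ
        ; distrib = *ₚ-distribˡ , λ a b c → *ₚ-distribʳ b c a }
      ; *-comm = *ₚ-comm } }

  -- len a = deg a + 1 for a ≉ 0, and len a = 0 for a ≈ 0.
  len : Poly → ℕ
  len a = length (trim a)

  len-cong : ∀ {a b} → a ≈ b → len a ≡ len b
  len-cong {a} {b} a≈b = cong length (≈⇒trim≡ a b a≈b)

  Bounded : Poly → ℕ → Set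
  Bounded a n = ∀ k → n ≤ k → coeff a k ≡ 0#

  bounded-length : ∀ a → Bounded a (length a)
  bounded-length [] k _ = refl
  bounded-length (x ∷ xs) (suc k) (s≤s le) = bounded-length xs k le

  bounded-zero : ∀ a → Bounded a 0 → a ≈ []
  bounded-zero a bnd = coeffwise λ k → bnd k z≤n

  len≤⇒bounded : ∀ a {n} → len a ≤ n → Bounded a n
  len≤⇒bounded a len≤n k n≤k =
    trans (sym (coeff-trim a k)) (bounded-length (trim a) k (ℕ.≤-trans len≤n n≤k))

  len-zero : ∀ {a} → a ≈ [] → len a ≡ 0
  len-zero {a} a≈0 = cong length (trim-zero a a≈0)

  len≡0 : ∀ a → len a ≡ 0 → a ≈ []
  len≡0 a len≡0 = bounded-zero a (len≤⇒bounded a (ℕ.≤-reflexive len≡0))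

  len-∷ : ∀ x xs → len (x ∷ xs) ≤ suc (len xs)
  len-∷ x xs with trim xs | x Fin.≟ 0#
  ... | [] | yes _ = z≤n
  ... | [] | no _ = s≤s z≤n
  ... | _ ∷ _ | _ = ℕ.≤-refl

  bounded⇒len≤ : ∀ a n → Bounded a n → len a ≤ n
  bounded⇒len≤ [] n _ = z≤n
  bounded⇒len≤ (x ∷ xs) zero bnd = ℕ.≤-reflexive (len-zero (bounded-zero (x ∷ xs) bnd))
  bounded⇒len≤ (x ∷ xs) (suc n) bnd =
    ℕ.≤-trans (len-∷ x xs) (s≤s (bounded⇒len≤ xs n λ k le → bnd (suc k) (s≤s le)))

  leading-nonzero : ∀ a {n} → len a ≡ suc n → coeff a n ≢ 0#
  leading-nonzero a {n} len≡ lead≡0 =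
    ℕ.<⇒≱ (ℕ.≤-reflexive (sym len≡)) (bounded⇒len≤ a n bnd)
    where
      bnd : Bounded a n
      bnd k n≤k with ℕ.m≤n⇒m<n∨m≡n n≤k
      ... | inj₁ n<k = len≤⇒bounded a (ℕ.≤-reflexive len≡) k n<k
      ... | inj₂ refl = lead≡0

  len-exact : ∀ a {n} → Bounded a (suc n) → coeff a n ≢ 0# → len a ≡ suc n
  len-exact a {n} bnd lead≢0 with ℕ.m≤n⇒m<n∨m≡n (bounded⇒len≤ a (suc n) bnd)
  ... | inj₂ len≡ = len≡
  ... | inj₁ (s≤s len≤n) = ⊥-elim (lead≢0 (len≤⇒bounded a len≤n n ℕ.≤-refl))

  zero? : ∀ a → Dec (a ≈ [])
  zero? a with len a in len≡
  ... | zero = yes (len≡0 a len≡)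
  ... | suc _ = no λ a≈0 → case trans (sym len≡) (len-zero a≈0) of λ ()

  nonconstant⇒nonzero : ∀ {a} → 2 ≤ len a → ¬ a ≈ []
  nonconstant⇒nonzero 2≤len a≈0 = ℕ.<⇒≱ (ℕ.≤-trans (s≤s z≤n) 2≤len) (ℕ.≤-reflexive (len-zero a≈0))

  nonzero-len : ∀ {a} → ¬ a ≈ [] → ∃ λ n → len a ≡ suc n
  nonzero-len {a} a≉0 with len a in len≡
  ... | zero = ⊥-elim (a≉0 (len≡0 a len≡))
  ... | suc n = n , refl

  coeff-∷*ₚ : ∀ x xs b k → coeff ((x ∷ xs) *ₚ b) (suc k) ≡ (x * coeff b (suc k)) + coeff (xs *ₚ b) k
  coeff-∷*ₚ x xs b k =
    trans (coeff-+ (scale x b) (shift (xs *ₚ b)) (suc k)) (cong (_+ _) (coeff-scale x b (suc k)))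

  coeff-∷*ₚ₀ : ∀ x xs b → coeff ((x ∷ xs) *ₚ b) 0 ≡ x * coeff b 0
  coeff-∷*ₚ₀ x xs b =
    trans (coeff-+ (scale x b) (shift (xs *ₚ b)) 0) (trans (cong (_+ 0#) (coeff-scale x b 0)) (+-identityʳ _))

  *ₚ-bounded : ∀ a b m j → Bounded a m → Bounded b (suc j) → Bounded (a *ₚ b) (m ℕ.+ j)
  *ₚ-bounded a b zero j bnd-a _ k _ = at (zero-*ₚ b (bounded-zero a bnd-a)) k
  *ₚ-bounded [] b (suc m) j _ _ _ _ = refl
  *ₚ-bounded (x ∷ xs) b (suc m) j bnd-a bnd-b (suc k) (s≤s m+j≤k) = begin
      coeff ((x ∷ xs) *ₚ b) (suc k)          ≡⟨ coeff-∷*ₚ x xs b k ⟩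
      (x * coeff b (suc k)) + coeff (xs *ₚ b) k
        ≡⟨ cong₂ _+_ (cong (x *_) (bnd-b (suc k) (s≤s (ℕ.≤-trans (ℕ.m≤n+m j m) m+j≤k))))
                     (*ₚ-bounded xs b m j (λ k' le → bnd-a (suc k') (s≤s le)) bnd-b k m+j≤k) ⟩
      (x * 0#) + 0#                           ≡⟨ trans (+-identityʳ _) (zeroʳ x) ⟩
      0#                                      ∎
    where open ≡-Reasoning

  *ₚ-top-coeff : ∀ a b i j → Bounded a (suc i) → Bounded b (suc j) →
                coeff (a *ₚ b) (i ℕ.+ j) ≡ coeff a i * coeff b j
  *ₚ-top-coeff [] b i j _ _ = sym (zeroˡ _)
  *ₚ-top-coeff (x ∷ xs) b zero j bnd-a _ = begin
      coeff ((x ∷ xs) *ₚ b) j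
        ≡⟨ at (*ₚ-congˡ b (∷-cong refl (bounded-zero xs λ k _ → bnd-a (suc k) (s≤s z≤n)))) j ⟩
      coeff ((x ∷ []) *ₚ b) j   ≡⟨ at (const-*ₚ x b) j ⟩
      coeff (scale x b) j       ≡⟨ coeff-scale x b j ⟩
      x * coeff b j             ∎
    where open ≡-Reasoning
  *ₚ-top-coeff (x ∷ xs) b (suc i) j bnd-a bnd-b = begin
      coeff ((x ∷ xs) *ₚ b) (suc (i ℕ.+ j))       ≡⟨ coeff-∷*ₚ x xs b (i ℕ.+ j) ⟩
      (x * coeff b (suc (i ℕ.+ j))) + coeff (xs *ₚ b) (i ℕ.+ j)
        ≡⟨ cong₂ _+_ (cong (x *_) (bnd-b _ (s≤s (ℕ.m≤n+m j i))))
                     (*ₚ-top-coeff xs b i j (λ k le → bnd-a (suc k) (s≤s le)) bnd-b) ⟩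
      (x * 0#) + (coeff xs i * coeff b j)         ≡⟨ trans (cong (_+ (coeff xs i * coeff b j)) (zeroʳ x)) (+-identityˡ _) ⟩
      coeff xs i * coeff b j                      ∎
    where open ≡-Reasoning

  len-*ₚ : ∀ {a b i j} → len a ≡ suc i → len b ≡ suc j → len (a *ₚ b) ≡ suc (i ℕ.+ j)
  len-*ₚ {a} {b} {i} {j} len-a len-b =
    len-exact (a *ₚ b) (*ₚ-bounded a b (suc i) j bnd-a bnd-b) top≢0
    where
      bnd-a : Bounded a (suc i)
      bnd-a = len≤⇒bounded a (ℕ.≤-reflexive len-a)
      bnd-b : Bounded b (suc j)
      bnd-b = len≤⇒bounded b (ℕ.≤-reflexive len-b)
      top≢0 : coeff (a *ₚ b) (i ℕ.+ j) ≢ 0#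
      top≢0 top≡0 with no-zero-divisors _ _ (trans (sym (*ₚ-top-coeff a b i j bnd-a bnd-b)) top≡0)
      ... | inj₁ lead-a≡0 = leading-nonzero a len-a lead-a≡0
      ... | inj₂ lead-b≡0 = leading-nonzero b len-b lead-b≡0

  *ₚ-zero-divisor : ∀ a b → a *ₚ b ≈ [] → a ≈ [] ⊎ b ≈ []
  *ₚ-zero-divisor a b ab≈0 with zero? a | zero? b
  ... | yes a≈0 | _ = inj₁ a≈0
  ... | no _ | yes b≈0 = inj₂ b≈0
  ... | no a≉0 | no b≉0 with nonzero-len a≉0 | nonzero-len b≉0
  ... | (i , len-a) | (j , len-b) = case trans (sym (len-*ₚ {a} {b} len-a len-b)) (len-zero ab≈0) of λ ()

  module PolyRing = RingProperties (CommutativeRing.ring poly-CR)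
  module PolyGroup = GroupProperties (CommutativeRing.+-group poly-CR)

  +ₚ-cancel : ∀ x y z → (x +ₚ y) +ₚ (z +ₚ -ₚ x) ≈ y +ₚ z
  +ₚ-cancel x y z = begin
      (x +ₚ y) +ₚ (z +ₚ -ₚ x)     ≈⟨ +ₚ-cong (+ₚ-comm x y) (+ₚ-comm z (-ₚ x)) ⟩
      (y +ₚ x) +ₚ (-ₚ x +ₚ z)     ≈⟨ +ₚ-assoc y x _ ⟩
      y +ₚ (x +ₚ (-ₚ x +ₚ z))     ≈⟨ +ₚ-cong ≈-refl (PolyGroup.\\-leftDividesˡ x z) ⟩
      y +ₚ z                      ∎
    where open SetoidReasoning ≈-setoid

  open DivisibilityProperties (CommutativeRing.*-monoid poly-CR)
    using (_∣ˡ_; _,_; ∣ˡ-refl; ∣ˡ-trans; ∣ˡ-respʳ-≈; ∣ˡ-respˡ-≈; x∣ˡy⇒x∣ˡyz)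

  ∣-+ : ∀ {d a b} → d ∣ˡ a → d ∣ˡ b → d ∣ˡ a +ₚ b
  ∣-+ {d} (h , dh≈a) (h' , dh'≈b) = h +ₚ h' , ≈-trans (*ₚ-distribˡ d h h') (+ₚ-cong dh≈a dh'≈b)

  ∣-neg : ∀ {d a} → d ∣ˡ a → d ∣ˡ -ₚ a
  ∣-neg {d} (h , dh≈a) = -ₚ h , ≈-trans (≈-sym (PolyRing.-‿distribʳ-* d h)) (-ₚ-cong dh≈a)

  zero-∣ : ∀ {d n} → d ≈ [] → d ∣ˡ n → n ≈ []
  zero-∣ d≈0 (h , dh≈n) = ≈-trans (≈-sym dh≈n) (zero-*ₚ h d≈0)

  ∣-zero : ∀ d {n} → n ≈ [] → d ∣ˡ n
  ∣-zero d n≈0 = [] , ≈-trans (*ₚ-zero d) (≈-sym n≈0)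

  ∣-len : ∀ {d n} → d ∣ˡ n → ¬ n ≈ [] → len d ≤ len n
  ∣-len {d} {n} (h , dh≈n) n≉0 with zero? d | zero? h
  ... | yes d≈0 | _ = ⊥-elim (n≉0 (zero-∣ d≈0 (h , dh≈n)))
  ... | no _ | yes h≈0 = ⊥-elim (n≉0 (≈-trans (≈-sym dh≈n) (≈-trans (*ₚ-congʳ d h≈0) (*ₚ-zero d))))
  ... | no d≉0 | no h≉0 with nonzero-len d≉0 | nonzero-len h≉0
  ... | (i , len-d) | (j , len-h) =
    subst₂ _≤_ (sym len-d) (trans (sym (len-*ₚ {d} {h} len-d len-h)) (len-cong dh≈n)) (s≤s (ℕ.m≤m+n i j))

  ∣ₚ⇒∣ˡ : ∀ {d n} → d ∣ₚ n → d ∣ˡ n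
  ∣ₚ⇒∣ˡ (h , trim≡) = h , trim≡⇒≈ trim≡

  ∣ˡ⇒∣ₚ : ∀ {d n} → d ∣ˡ n → d ∣ₚ n
  ∣ˡ⇒∣ₚ {d} {n} (h , dh≈n) = h , ≈⇒trim≡ (d *ₚ h) n dh≈n

  module LongDivision (g : Poly) {m : ℕ} (len-g : len g ≡ suc m) where
    lead : Fin q
    lead = coeff g m

    lead⁻¹ : Fin q
    lead⁻¹ = proj₁ (inverse lead (leading-nonzero g len-g))

    bounded-g : Bounded g (suc m)
    bounded-g = len≤⇒bounded g (ℕ.≤-reflexive len-g)

    Division : Poly → Set
    Division f = ∃₂ λ s r → f ≈ g *ₚ s +ₚ r × Bounded r m

    reduce : ∀ r → Bounded r (suc m) → Bounded (r +ₚ -ₚ scale (coeff r m * lead⁻¹) g) m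
    reduce r bnd-r k m≤k = begin
        coeff (r +ₚ -ₚ scale e g) k         ≡⟨ coeff-+ r _ k ⟩
        coeff r k + coeff (-ₚ scale e g) k
          ≡⟨ cong (coeff r k +_) (trans (coeff-neg (scale e g) k) (cong -_ (coeff-scale e g k))) ⟩
        coeff r k + (- (e * coeff g k))     ≡⟨ vanish (ℕ.m≤n⇒m<n∨m≡n m≤k) ⟩
        0#                                  ∎
      where
        open ≡-Reasoning
        e = coeff r m * lead⁻¹
        vanish : m < k ⊎ m ≡ k → coeff r k + (- (e * coeff g k)) ≡ 0#
        vanish (inj₁ m<k) = begin
            coeff r k + (- (e * coeff g k)) ≡⟨ cong₂ (λ x y → x + (- (e * y))) (bnd-r k m<k) (bounded-g k m<k) ⟩
            0# + (- (e * 0#))               ≡⟨ trans (+-identityˡ _) (trans (cong -_ (zeroʳ e)) ε⁻¹≈ε) ⟩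
            0#                              ∎
        vanish (inj₂ refl) = begin
            coeff r m + (- (e * lead))      ≡⟨ cong (λ x → coeff r m + (- x)) (*-assoc _ lead⁻¹ lead) ⟩
            coeff r m + (- (coeff r m * (lead⁻¹ * lead)))
              ≡⟨ cong (λ x → coeff r m + (- (coeff r m * x))) (trans (*-comm lead⁻¹ lead) (proj₂ (inverse lead _))) ⟩
            coeff r m + (- (coeff r m * 1#)) ≡⟨ cong (λ x → coeff r m + (- x)) (*-identityʳ _) ⟩
            coeff r m + (- coeff r m)        ≡⟨ -‿inverseʳ _ ⟩
            0#                               ∎

    -- Division by recursion on the coefficient list: if f = g·s + r then
    -- x ∷ f = x + T·f = g·(e ∷ s) + ((x ∷ r) − e·g) for e the scalar of `reduce`.
    divide : ∀ f → Division f
    divide [] = [] , [] , ≈-sym (+ₚ-cong (*ₚ-zero g) ≈-refl) , λ _ _ → refl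
    divide (x ∷ f) with divide f
    ... | s , r , f≈ , bnd-r = e ∷ s , (x ∷ r) +ₚ -ₚ scale e g , x∷f≈ , reduce (x ∷ r) bnd-x∷r
      where
        e = coeff (x ∷ r) m * lead⁻¹
        bnd-x∷r : Bounded (x ∷ r) (suc m)
        bnd-x∷r (suc k) (s≤s m≤k) = bnd-r k m≤k
        x∷f≈ : x ∷ f ≈ g *ₚ (e ∷ s) +ₚ ((x ∷ r) +ₚ -ₚ scale e g)
        x∷f≈ = begin
            x ∷ f                                         ≈⟨ ∷-cong (sym (+-identityˡ x)) f≈ ⟩
            shift (g *ₚ s) +ₚ (x ∷ r)                     ≈⟨ ≈-sym (+ₚ-cancel (scale e g) _ _) ⟩
            (scale e g +ₚ shift (g *ₚ s)) +ₚ ((x ∷ r) +ₚ -ₚ scale e g)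
              ≈⟨ +ₚ-cong (+ₚ-cong (≈-refl {scale e g}) (shift-cong (*ₚ-comm g s))) ≈-refl ⟩
            (e ∷ s) *ₚ g +ₚ ((x ∷ r) +ₚ -ₚ scale e g)    ≈⟨ +ₚ-cong (*ₚ-comm (e ∷ s) g) ≈-refl ⟩
            g *ₚ (e ∷ s) +ₚ ((x ∷ r) +ₚ -ₚ scale e g)    ∎
          where open SetoidReasoning ≈-setoid

  record Bezout (a b : Poly) : Set where
    constructor bezout
    field
      gcd   : Poly
      gcd∣a : gcd ∣ˡ a
      gcd∣b : gcd ∣ˡ b
      u v   : Poly
      gcd≈  : gcd ≈ a *ₚ u +ₚ b *ₚ v

  bezout-step : ∀ {a b s r} → a ≈ b *ₚ s +ₚ r → Bezout b r → Bezout a b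
  bezout-step {a} {b} {s} {r} a≈ (bezout g g∣b g∣r u v g≈) =
    bezout g (∣ˡ-respʳ-≈ (≈-sym a≈) (∣-+ (x∣ˡy⇒x∣ˡyz s g∣b) g∣r)) g∣b v (u +ₚ -ₚ (s *ₚ v)) g≈'
    where
      open SetoidReasoning ≈-setoid
      g≈' : g ≈ a *ₚ v +ₚ b *ₚ (u +ₚ -ₚ (s *ₚ v))
      g≈' = begin
        g                                                    ≈⟨ ≈-trans g≈ (+ₚ-comm (b *ₚ u) (r *ₚ v)) ⟩
        r *ₚ v +ₚ b *ₚ u                                     ≈⟨ ≈-sym (+ₚ-cancel (b *ₚ (s *ₚ v)) _ _) ⟩
        (b *ₚ (s *ₚ v) +ₚ r *ₚ v) +ₚ (b *ₚ u +ₚ -ₚ (b *ₚ (s *ₚ v)))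
          ≈⟨ +ₚ-cong (+ₚ-cong (≈-sym (*ₚ-assoc b s v)) ≈-refl)
                     (+ₚ-cong ≈-refl (PolyRing.-‿distribʳ-* b (s *ₚ v))) ⟩
        ((b *ₚ s) *ₚ v +ₚ r *ₚ v) +ₚ (b *ₚ u +ₚ b *ₚ (-ₚ (s *ₚ v)))
          ≈⟨ +ₚ-cong (≈-sym (*ₚ-distribʳ (b *ₚ s) r v)) (≈-sym (*ₚ-distribˡ b u _)) ⟩
        (b *ₚ s +ₚ r) *ₚ v +ₚ b *ₚ (u +ₚ -ₚ (s *ₚ v))
          ≈⟨ +ₚ-cong (*ₚ-congˡ v (≈-sym a≈)) ≈-refl ⟩
        a *ₚ v +ₚ b *ₚ (u +ₚ -ₚ (s *ₚ v))                    ∎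

  bezout-bounded : ∀ n a b → len b ≤ n → Bezout a b
  bezout-bounded n a b len-b≤n with zero? b
  ... | yes b≈0 = bezout a ∣ˡ-refl (∣-zero a b≈0) 1ₚ []
                    (≈-sym (≈-trans (+ₚ-cong (*ₚ-identityʳ a) (*ₚ-zero b)) (+ₚ-identityʳ a)))
  ... | no b≉0 with nonzero-len b≉0
  ... | m , len-b with LongDivision.divide b len-b a | n
  ... | _ | zero = ⊥-elim (ℕ.<⇒≱ (ℕ.≤-reflexive (sym len-b)) (ℕ.≤-trans len-b≤n z≤n))
  ... | s , r , a≈ , bnd-r | suc n =
    bezout-step a≈ (bezout-bounded n b r
      (ℕ.≤-trans (bounded⇒len≤ r m bnd-r) (ℕ.≤-pred (subst (_≤ suc n) len-b len-b≤n))))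

  bezout-exists : ∀ a b → Bezout a b
  bezout-exists a b = bezout-bounded (len b) a b ℕ.≤-refl

  normal-tail : ∀ x xs → Normal (x ∷ xs) → Normal xs
  normal-tail x xs normal with trim xs | x Fin.≟ 0#
  ... | [] | no _ = proj₂ (∷-injective normal)
  ... | _ ∷ _ | _ = proj₂ (∷-injective normal)

  normal-∷ : ∀ x xs → Normal xs → xs ≢ [] → Normal (x ∷ xs)
  normal-∷ x xs normal xs≢[] with trim xs
  ... | [] = ⊥-elim (xs≢[] (sym normal))
  ... | _ ∷ _ = cong (x ∷_) normal

  normal-const : ∀ x → x ≢ 0# → Normal (x ∷ [])
  normal-const x x≢0 with x Fin.≟ 0#
  ... | yes x≡0 = ⊥-elim (x≢0 x≡0)
  ... | no _ = refl

  normal-const⁻¹ : ∀ x → Normal (x ∷ []) → x ≢ 0#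
  normal-const⁻¹ x normal x≡0 with x Fin.≟ 0#
  ... | yes _ = case normal of λ ()
  ... | no x≢0 = x≢0 x≡0

  normal-len : ∀ {a} → Normal a → len a ≡ length a
  normal-len = cong length

  normal-nonzero : ∀ {a} → Normal a → a ≢ [] → ¬ a ≈ []
  normal-nonzero {a} normal a≢[] a≈0 = a≢[] (trans (sym normal) (trim-zero a a≈0))

  constants : List Poly
  constants = map (_∷ []) (allExcept 0#)

  ∈-constants⁻ : ∀ {A} → A ∈ constants → ∃ λ x → A ≡ x ∷ [] × x ≢ 0#
  ∈-constants⁻ A∈ with ∈-map⁻ (_∷ []) A∈
  ... | x , x∈ , refl = x , refl , ∈-allExcept⁻ x∈

  ∈-constants⁺ : ∀ {x} → x ≢ 0# → x ∷ [] ∈ constants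
  ∈-constants⁺ x≢0 = ∈-map⁺ (_∷ []) (∈-allExcept⁺ x≢0)

  constants-unique : Unique constants
  constants-unique = UniqueP.map⁺ (λ eq → proj₁ (∷-injective eq)) (allExcept-unique 0#)

  constants-length : length constants ≡ q ∸ 1
  constants-length = trans (length-map (_∷ []) (allExcept 0#)) (allExcept-length 0#)

  nonzeroPolys : ℕ → List Poly
  nonzeroPolys zero = []
  nonzeroPolys (suc n) = constants ++ cartesianProductWith _∷_ (allFin q) (nonzeroPolys n)

  nonzeroPolys-sound : ∀ n {A} → A ∈ nonzeroPolys n → Normal A × A ≢ [] × length A ≤ n
  nonzeroPolys-sound (suc n) A∈ with ∈-++⁻ constants A∈
  ... | inj₁ A∈c with ∈-constants⁻ A∈c
  ...   | x , refl , x≢0 = normal-const x x≢0 , (λ ()) , s≤s z≤n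
  nonzeroPolys-sound (suc n) A∈ | inj₂ A∈p with ∈-cartesianProductWith⁻ _∷_ (allFin q) (nonzeroPolys n) A∈p
  ...   | x , B , _ , B∈ , refl with nonzeroPolys-sound n B∈
  ...     | normal-B , B≢[] , length-B = normal-∷ x B normal-B B≢[] , (λ ()) , s≤s length-B

  nonzeroPolys-complete : ∀ n {A} → Normal A → A ≢ [] → length A ≤ n → A ∈ nonzeroPolys n
  nonzeroPolys-complete n {[]} _ A≢[] _ = ⊥-elim (A≢[] refl)
  nonzeroPolys-complete (suc n) {x ∷ []} normal _ _ = ∈-++⁺ˡ (∈-constants⁺ (normal-const⁻¹ x normal))
  nonzeroPolys-complete (suc n) {x ∷ y ∷ ys} normal _ (s≤s length≤n) =
    ∈-++⁺ʳ constants (∈-cartesianProductWith⁺ _∷_ (∈-allFin x)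
      (nonzeroPolys-complete n (normal-tail x (y ∷ ys) normal) (λ ()) length≤n))

  nonzeroPolys-unique : ∀ n → Unique (nonzeroPolys n)
  nonzeroPolys-unique zero = []
  nonzeroPolys-unique (suc n) = UniqueP.++⁺ constants-unique
      (UniqueP.cartesianProductWith⁺ _∷_ ∷-injective (UniqueP.allFin⁺ q) (nonzeroPolys-unique n))
      disjoint
    where
      -- constants have one coefficient, the other elements at least two
      disjoint : ∀ {A} → ¬ (A ∈ constants × A ∈ cartesianProductWith _∷_ (allFin q) (nonzeroPolys n))
      disjoint (A∈c , A∈p) with ∈-constants⁻ A∈c | ∈-cartesianProductWith⁻ _∷_ (allFin q) (nonzeroPolys n) A∈p
      ... | _ , refl , _ | _ , B , _ , B∈ , eq = proj₁ (proj₂ (nonzeroPolys-sound n B∈)) (sym (proj₂ (∷-injective eq)))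

  nonzeroPolys-length : ∀ n → length (nonzeroPolys n) ≡ q ^ n ∸ 1
  nonzeroPolys-length zero = refl
  nonzeroPolys-length (suc n) = begin
      length (constants ++ cartesianProductWith _∷_ (allFin q) (nonzeroPolys n))
        ≡⟨ length-++ constants ⟩
      length constants ℕ.+ length (cartesianProductWith _∷_ (allFin q) (nonzeroPolys n))
        ≡⟨ cong₂ ℕ._+_ constants-length (length-cartesianProductWith _∷_ (allFin q) (nonzeroPolys n)) ⟩
      (q ∸ 1) ℕ.+ length (allFin q) ℕ.* length (nonzeroPolys n)
        ≡⟨ cong₂ (λ a b → (q ∸ 1) ℕ.+ a ℕ.* b) (length-tabulate {n = q} (λ x → x)) (nonzeroPolys-length n) ⟩
      (q ∸ 1) ℕ.+ q ℕ.* (q ^ n ∸ 1)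
        ≡⟨ geometric-step q n ⟩
      q ^ suc n ∸ 1 ∎
    where open ≡-Reasoning

  const-∣ : ∀ {x} → x ≢ 0# → ∀ a → (x ∷ []) ∣ˡ a
  const-∣ {x} x≢0 a = scale x⁻¹ a , (begin
      (x ∷ []) *ₚ scale x⁻¹ a   ≈⟨ const-*ₚ x (scale x⁻¹ a) ⟩
      scale x (scale x⁻¹ a)     ≈⟨ ≈-sym (scale-* x x⁻¹ a) ⟩
      scale (x * x⁻¹) a         ≈⟨ ≈-reflexive (cong (λ c → scale c a) (proj₂ (inverse x x≢0))) ⟩
      scale 1# a                ≈⟨ scale-one a ⟩
      a                         ∎)
    where
      open SetoidReasoning ≈-setoid
      x⁻¹ = proj₁ (inverse x x≢0)

  T-∣-cofactor : ∀ {x xs h c} → x ≢ 0# → (x ∷ xs) *ₚ h ≈ shift c → ∃ λ h' → h ≈ shift h'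
  T-∣-cofactor {h = []} _ _ = [] , ≈-sym shift-zero
  T-∣-cofactor {x} {xs} {y ∷ ys} x≢0 xh≈Tc
    with no-zero-divisors x y (trans (sym (coeff-∷*ₚ₀ x xs (y ∷ ys))) (at xh≈Tc 0))
  ... | inj₁ x≡0 = ⊥-elim (x≢0 x≡0)
  ... | inj₂ y≡0 = ys , ∷-cong y≡0 ≈-refl

  shift-cancel : ∀ {a b} → shift a ≈ shift b → a ≈ b
  shift-cancel = ∷-tail

  T^_ : ℕ → Poly
  T^ zero = 1ₚ
  T^ suc k = shift (T^ k)

  T^-nonzero : ∀ k → ¬ T^ k ≈ []
  T^-nonzero zero 1≈0 = 0≢1 (sym (at 1≈0 0))
  T^-nonzero (suc k) Tk≈0 = T^-nonzero k (zero∷-tail Tk≈0)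

  T^-nonempty : ∀ k → T^ k ≢ []
  T^-nonempty k Tk≡[] = T^-nonzero k (≈-reflexive Tk≡[])

  T^-normal : ∀ k → Normal (T^ k)
  T^-normal zero = normal-const 1# (λ 1≡0 → 0≢1 (sym 1≡0))
  T^-normal (suc k) = normal-∷ 0# (T^ k) (T^-normal k) (T^-nonempty k)

  -- The nonzero monomials c·Tʲ with j < n: the divisors of Tⁿ⁻¹.
  monomials : ℕ → List Poly
  monomials zero = []
  monomials (suc n) = constants ++ map shift (monomials n)

  monomials-sound : ∀ n {D} → D ∈ monomials n → Normal D × D ≢ []
  monomials-sound (suc n) D∈ with ∈-++⁻ constants D∈
  ... | inj₁ D∈c with ∈-constants⁻ D∈c
  ...   | x , refl , x≢0 = normal-const x x≢0 , λ ()
  monomials-sound (suc n) D∈ | inj₂ D∈s with ∈-map⁻ shift D∈s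
  ...   | D' , D'∈ , refl with monomials-sound n D'∈
  ...     | normal-D' , D'≢[] = normal-∷ 0# D' normal-D' D'≢[] , λ ()

  monomials-∣ : ∀ k {D} → D ∈ monomials (suc k) → D ∣ˡ T^ k
  monomials-∣ k D∈ with ∈-++⁻ constants D∈
  ... | inj₁ D∈c with ∈-constants⁻ D∈c
  ...   | x , refl , x≢0 = const-∣ x≢0 (T^ k)
  monomials-∣ (suc k) D∈ | inj₂ D∈s with ∈-map⁻ shift D∈s
  ...   | D' , D'∈ , refl with monomials-∣ k D'∈
  ...     | h , D'h≈Tk = h , ≈-trans (shift-*ₚ D' h) (shift-cong D'h≈Tk)

  monomials-mono : ∀ n {D} → D ∈ monomials n → D ∈ monomials (suc n)
  monomials-mono (suc n) D∈ with ∈-++⁻ constants D∈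
  ... | inj₁ D∈c = ∈-++⁺ˡ D∈c
  ... | inj₂ D∈s with ∈-map⁻ shift D∈s
  ...   | D' , D'∈ , refl = ∈-++⁺ʳ constants (∈-map⁺ shift (monomials-mono n D'∈))

  -- Every normal divisor of Tᵏ is a monomial: strip a factor T from the divisor when its
  -- constant term vanishes, and from the cofactor otherwise (F_q has no zero divisors).
  monomials-complete : ∀ k {D} → Normal D → D ∣ˡ T^ k → D ∈ monomials (suc k)
  monomials-complete k {[]} _ (h , 0≈Tk) = ⊥-elim (T^-nonzero k (≈-sym 0≈Tk))
  monomials-complete zero {x ∷ xs} normal D∣1 with xs | ∣-len D∣1 (T^-nonzero 0)
  ... | [] | _ = ∈-++⁺ˡ (∈-constants⁺ (normal-const⁻¹ x normal))
  ... | _ ∷ _ | len≤1 =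
    ⊥-elim (ℕ.<⇒≱ (s≤s (s≤s z≤n)) (subst₂ _≤_ (normal-len normal) (normal-len (T^-normal 0)) len≤1))
  monomials-complete (suc k) {x ∷ xs} normal (h , Dh≈Tk) = by-constant-term (x Fin.≟ 0#)
    where
      by-constant-term : Dec (x ≡ 0#) → x ∷ xs ∈ monomials (suc (suc k))
      by-constant-term (yes refl) = ∈-++⁺ʳ constants (∈-map⁺ shift
        (monomials-complete k (normal-tail 0# xs normal) (h , shift-cancel (≈-trans (≈-sym (shift-*ₚ xs h)) Dh≈Tk))))
      by-constant-term (no x≢0) with T-∣-cofactor {xs = xs} x≢0 Dh≈Tk
      ... | h' , h≈Th' = monomials-mono (suc k) (monomials-complete k normal
        (h' , shift-cancel (≈-trans (≈-sym (*ₚ-shift (x ∷ xs) h'))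
                                    (≈-trans (*ₚ-congʳ (x ∷ xs) (≈-sym h≈Th')) Dh≈Tk))))

  monomials-unique : ∀ n → Unique (monomials n)
  monomials-unique zero = []
  monomials-unique (suc n) =
    UniqueP.++⁺ constants-unique (UniqueP.map⁺ (λ eq → proj₂ (∷-injective eq)) (monomials-unique n)) disjoint
    where
      -- constants have a nonzero constant term, multiples of T a zero one
      disjoint : ∀ {D} → ¬ (D ∈ constants × D ∈ map shift (monomials n))
      disjoint (D∈c , D∈s) with ∈-constants⁻ D∈c | ∈-map⁻ shift D∈s
      ... | x , refl , x≢0 | _ , _ , eq = x≢0 (proj₁ (∷-injective eq))

  weight-constants : ∀ xs → sum (map ∣_∣ₚ (map (_∷ []) xs)) ≡ length xs
  weight-constants [] = refl
  weight-constants (x ∷ xs) = cong suc (weight-constants xs)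

  weight-shift : ∀ Ds → (∀ {D} → D ∈ Ds → D ≢ []) →
                 sum (map ∣_∣ₚ (map shift Ds)) ≡ q ℕ.* sum (map ∣_∣ₚ Ds)
  weight-shift [] _ = sym (ℕ.*-zeroʳ q)
  weight-shift ([] ∷ Ds) nonempty = ⊥-elim (nonempty (here refl) refl)
  weight-shift ((x ∷ D) ∷ Ds) nonempty =
    trans (cong (q ℕ.* q ^ length D ℕ.+_) (weight-shift Ds (λ D∈ → nonempty (there D∈))))
          (sym (ℕ.*-distribˡ-+ q (q ^ length D) _))

  monomials-weight : ∀ n → sum (map ∣_∣ₚ (monomials n)) ≡ q ^ n ∸ 1
  monomials-weight zero = refl
  monomials-weight (suc n) = begin
      sum (map ∣_∣ₚ (constants ++ map shift (monomials n)))
        ≡⟨ trans (cong sum (map-++ ∣_∣ₚ constants _)) (sum-++ (map ∣_∣ₚ constants) _) ⟩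
      sum (map ∣_∣ₚ constants) ℕ.+ sum (map ∣_∣ₚ (map shift (monomials n)))
        ≡⟨ cong₂ ℕ._+_ (trans (weight-constants (allExcept 0#)) (allExcept-length 0#))
                       (weight-shift (monomials n) (λ D∈ → proj₂ (monomials-sound n D∈))) ⟩
      (q ∸ 1) ℕ.+ q ℕ.* sum (map ∣_∣ₚ (monomials n))
        ≡⟨ cong (λ w → (q ∸ 1) ℕ.+ q ℕ.* w) (monomials-weight n) ⟩
      (q ∸ 1) ℕ.+ q ℕ.* (q ^ n ∸ 1)
        ≡⟨ geometric-step q n ⟩
      q ^ suc n ∸ 1 ∎
    where open ≡-Reasoning

  InvertibleMod : Poly → Poly → Set
  InvertibleMod P A = ∃ λ B → P ∣ˡ A *ₚ B +ₚ -ₚ 1ₚ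

  invertible-cong : ∀ {P A A'} → A ≈ A' → InvertibleMod P A → InvertibleMod P A'
  invertible-cong A≈A' (B , P∣) = B , ∣ˡ-respʳ-≈ (+ₚ-cong (*ₚ-congˡ B A≈A') ≈-refl) P∣

  -- P is a field modulus when every nonzero residue of smaller degree is invertible modulo P,
  -- i.e. when F_q[T]/(P) is a field (P is irreducible).
  FieldModulus : Poly → Set
  FieldModulus P = ∀ A → ¬ A ≈ [] → len A < len P → InvertibleMod P A

  ProperFactor : Poly → Set
  ProperFactor P = ∃ λ E → E ∣ˡ P × 2 ≤ len E × len E < len P

  invertible-from-bezout : ∀ {P A} U V → 1ₚ ≈ P *ₚ U +ₚ A *ₚ V → InvertibleMod P A
  invertible-from-bezout {P} {A} U V 1≈ = V , -ₚ U , (begin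
      P *ₚ (-ₚ U)                            ≈⟨ ≈-sym (PolyRing.-‿distribʳ-* P U) ⟩
      -ₚ (P *ₚ U)                            ≈⟨ ≈-sym (PolyGroup.\\-leftDividesˡ (A *ₚ V) _) ⟩
      A *ₚ V +ₚ (-ₚ (A *ₚ V) +ₚ -ₚ (P *ₚ U))
        ≈⟨ +ₚ-cong ≈-refl (≈-sym (PolyGroup.⁻¹-anti-homo-∙ (P *ₚ U) (A *ₚ V))) ⟩
      A *ₚ V +ₚ -ₚ (P *ₚ U +ₚ A *ₚ V)        ≈⟨ +ₚ-cong ≈-refl (-ₚ-cong (≈-sym 1≈)) ⟩
      A *ₚ V +ₚ -ₚ 1ₚ                        ∎)
    where open SetoidReasoning ≈-setoid

  constant-form : ∀ g → len g ≡ 1 → g ≈ coeff g 0 ∷ []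
  constant-form g len≡1 = coeffwise λ
    { zero → refl
    ; (suc k) → len≤⇒bounded g (ℕ.≤-reflexive len≡1) (suc k) (s≤s z≤n) }

  -- For a nonzero residue A, the gcd of P and A is either a constant (and then A is
  -- invertible) or a proper factor of P (its degree is at most deg A < deg P).
  invertible-or-factor : ∀ P A → ¬ A ≈ [] → len A < len P → InvertibleMod P A ⊎ ProperFactor P
  invertible-or-factor P A A≉0 A<P with bezout-exists P A
  ... | bezout g g∣P g∣A u v g≈ with nonzero-len {g} (λ g≈0 → A≉0 (zero-∣ g≈0 g∣A))
  ... | suc i , len-g =
    inj₂ (g , g∣P , subst (2 ≤_) (sym len-g) (s≤s (s≤s z≤n)) , ℕ.≤-<-trans (∣-len g∣A A≉0) A<P)
  ... | zero , len-g with const-∣ (leading-nonzero g len-g) 1ₚ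
  ... | h , ch≈1 = inj₁ (invertible-from-bezout {P} {A} (u *ₚ h) (v *ₚ h) (begin
      1ₚ                                    ≈⟨ ≈-sym ch≈1 ⟩
      (coeff g 0 ∷ []) *ₚ h                 ≈⟨ *ₚ-congˡ h (≈-sym (constant-form g len-g)) ⟩
      g *ₚ h                                ≈⟨ *ₚ-congˡ h g≈ ⟩
      (P *ₚ u +ₚ A *ₚ v) *ₚ h               ≈⟨ *ₚ-distribʳ (P *ₚ u) (A *ₚ v) h ⟩
      (P *ₚ u) *ₚ h +ₚ (A *ₚ v) *ₚ h        ≈⟨ +ₚ-cong (*ₚ-assoc P u h) (*ₚ-assoc A v h) ⟩
      P *ₚ (u *ₚ h) +ₚ A *ₚ (v *ₚ h)        ∎))
    where open SetoidReasoning ≈-setoid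

  -- Deciding whether P is a field modulus amounts to testing the finitely many nonzero residues.
  field-modulus-or-factor : ∀ P {n} → len P ≡ suc n → FieldModulus P ⊎ ProperFactor P
  field-modulus-or-factor P {n} len-P with all-or-exception (nonzeroPolys n) decide
    where
      decide : ∀ {A} → A ∈ nonzeroPolys n → InvertibleMod P A ⊎ ProperFactor P
      decide {A} A∈ with nonzeroPolys-sound n A∈
      ... | normal , A≢[] , length≤n = invertible-or-factor P A (normal-nonzero normal A≢[])
              (subst₂ _<_ (sym (normal-len normal)) (sym len-P) (s≤s length≤n))
  ... | inj₂ factor = inj₂ factor
  ... | inj₁ invertible = inj₁ λ A A≉0 A<P → invertible-cong (trim≈ A) (invertible
          (nonzeroPolys-complete n (trim-normal A) (λ trim≡[] → A≉0 (trim≡⇒≈ trim≡[]))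
            (ℕ.≤-pred (subst (len A <_) len-P A<P))))

  -- Every polynomial of positive degree has a divisor of positive degree that is a field
  -- modulus: descend along proper factors, which have strictly smaller degree.
  field-modulus-divisor-bounded : ∀ n N → len N ≤ n → 2 ≤ len N →
    ∃ λ P → P ∣ˡ N × 2 ≤ len P × FieldModulus P
  field-modulus-divisor-bounded n N len≤n 2≤len with nonzero-len (nonconstant⇒nonzero {N} 2≤len)
  ... | m , len-N with field-modulus-or-factor N len-N
  ... | inj₁ field-N = N , ∣ˡ-refl , 2≤len , field-N
  ... | inj₂ (E , E∣N , 2≤E , E<N) with n
  ...   | zero = ⊥-elim (ℕ.<⇒≱ (ℕ.≤-trans (s≤s z≤n) 2≤len) len≤n)
  ...   | suc n with field-modulus-divisor-bounded n E (ℕ.≤-pred (ℕ.≤-trans E<N len≤n)) 2≤E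
  ...     | P , P∣E , 2≤P , field-P = P , ∣ˡ-trans P∣E E∣N , 2≤P , field-P

  field-modulus-divisor : ∀ N → 2 ≤ len N → ∃ λ P → P ∣ˡ N × 2 ≤ len P × FieldModulus P
  field-modulus-divisor N = field-modulus-divisor-bounded (len N) N ℕ.≤-refl

  ∤-const : ∀ {P x} → 2 ≤ len P → x ≢ 0# → ¬ P ∣ˡ (x ∷ [])
  ∤-const {P} {x} 2≤P x≢0 P∣x = ℕ.<⇒≱ 2≤P (subst (len P ≤_) (normal-len (normal-const x x≢0))
                                  (∣-len P∣x (normal-nonzero (normal-const x x≢0) λ ())))

  -- φ(P) = qᵈ − 1 for a field modulus P of degree d = k + 1 ≥ 1: the invertible residues
  -- are exactly the nonzero polynomials of degree < d.
  phi-field-modulus : ∀ {P k} → FieldModulus P → len P ≡ suc (suc k) → PhiIs (trim P) (q ^ suc k ∸ 1)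
  phi-field-modulus {P} {k} field-P len-P =
    nonzeroPolys (suc k) , nonzeroPolys-unique (suc k) , sound , complete , nonzeroPolys-length (suc k)
    where
      unit-mod : ∀ {A} → InvertibleMod P A → UnitMod (trim P) A
      unit-mod {A} (B , P∣) = B , ∣ˡ⇒∣ₚ (∣ˡ-respˡ-≈ (≈-sym (trim≈ P)) P∣)

      sound : ∀ A → A ∈ nonzeroPolys (suc k) → Normal A × length A < len P × UnitMod (trim P) A
      sound A A∈ with nonzeroPolys-sound (suc k) A∈
      ... | normal , A≢[] , length≤ =
        normal , A<P , unit-mod {A} (field-P A (normal-nonzero normal A≢[]) (subst (_< len P) (sym (normal-len normal)) A<P))
        where
          A<P : length A < len P
          A<P = subst (length A <_) (sym len-P) (s≤s length≤)

      -- zero is not a unit: P would divide −1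
      complete : ∀ A → Normal A → length A < len P → UnitMod (trim P) A → A ∈ nonzeroPolys (suc k)
      complete [] _ _ (B , P∣-1) = ⊥-elim (∤-const {P} 2≤P -1≢0 (∣ˡ-respˡ-≈ (trim≈ P) (∣ₚ⇒∣ˡ P∣-1)))
        where
          2≤P : 2 ≤ len P
          2≤P = subst (2 ≤_) (sym len-P) (s≤s (s≤s z≤n))
          -1≢0 : - 1# ≢ 0#
          -1≢0 -1≡0 = 0≢1 (sym (⁻¹-injective (trans -1≡0 (sym ε⁻¹≈ε))))
      complete (x ∷ xs) normal A<P _ =
        nonzeroPolys-complete (suc k) normal (λ ()) (ℕ.≤-pred (subst (length (x ∷ xs) <_) len-P A<P))

  -- σ_nm(Tᵏ) = qᵏ⁺¹ − 1: the divisors of Tᵏ are the monomials of degree ≤ k.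
  sigma-T^ : ∀ k → SigmaNmIs (T^ k) (q ^ suc k ∸ 1)
  sigma-T^ k = monomials (suc k) , monomials-unique (suc k) ,
    (λ D D∈ → proj₁ (monomials-sound (suc k) D∈) , ∣ˡ⇒∣ₚ (monomials-∣ k D∈)) ,
    (λ D normal D∣ → monomials-complete k normal (∣ₚ⇒∣ˡ D∣)) ,
    monomials-weight (suc k)

  phi-equals-sigma : ∀ {P} → FieldModulus P → 2 ≤ len P →
    ∃ λ k → PhiIs (trim P) (q ^ suc k ∸ 1) × SigmaNmIs (T^ k) (q ^ suc k ∸ 1)
  phi-equals-sigma {P} field-P 2≤P = by-length (len P) refl 2≤P
    where
      by-length : ∀ n → len P ≡ n → 2 ≤ n →
        ∃ λ k → PhiIs (trim P) (q ^ suc k ∸ 1) × SigmaNmIs (T^ k) (q ^ suc k ∸ 1)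
      by-length (suc (suc k)) len-P _ = k , phi-field-modulus field-P len-P , sigma-T^ k
      by-length 1 _ (s≤s ())

  nonzeroProduct : List Poly → Poly
  nonzeroProduct [] = 1ₚ
  nonzeroProduct (F ∷ Fs) with zero? F
  ... | yes _ = nonzeroProduct Fs
  ... | no _ = F *ₚ nonzeroProduct Fs

  nonzeroProduct-nonzero : ∀ Fs → ¬ nonzeroProduct Fs ≈ []
  nonzeroProduct-nonzero [] = T^-nonzero 0
  nonzeroProduct-nonzero (F ∷ Fs) with zero? F
  ... | yes _ = nonzeroProduct-nonzero Fs
  ... | no F≉0 = λ FM≈0 → case *ₚ-zero-divisor F _ FM≈0 of λ
    { (inj₁ F≈0) → F≉0 F≈0
    ; (inj₂ M≈0) → nonzeroProduct-nonzero Fs M≈0 }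

  nonzeroProduct-∣ : ∀ Fs {F} → F ∈ Fs → ¬ F ≈ [] → F ∣ˡ nonzeroProduct Fs
  nonzeroProduct-∣ (F ∷ Fs) (here refl) F≉0 with zero? F
  ... | yes F≈0 = ⊥-elim (F≉0 F≈0)
  ... | no _ = x∣ˡy⇒x∣ˡyz (nonzeroProduct Fs) ∣ˡ-refl
  nonzeroProduct-∣ (F' ∷ Fs) (there F∈) F≉0 with zero? F'
  ... | yes _ = nonzeroProduct-∣ Fs F∈ F≉0
  ... | no _ = ∣ˡ-respʳ-≈ (*ₚ-comm _ F') (x∣ˡy⇒x∣ˡyz F' (nonzeroProduct-∣ Fs F∈ F≉0))

  -- 1 + T·∏Fs has positive degree, and none of its divisors of positive degree
  -- occurs in Fs: such a divisor would divide both 1 + T·∏Fs and T·∏Fs, hence 1.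
  euclid : List Poly → Poly
  euclid Fs = 1# ∷ nonzeroProduct Fs

  len-∷-nonzero : ∀ x {a} → ¬ a ≈ [] → len (x ∷ a) ≡ suc (len a)
  len-∷-nonzero x {a} a≉0 with trim a in trim-a
  ... | [] = ⊥-elim (a≉0 (trim≡⇒≈ trim-a))
  ... | _ ∷ _ = refl

  euclid-len : ∀ Fs → 2 ≤ len (euclid Fs)
  euclid-len Fs with nonzero-len (nonzeroProduct-nonzero Fs)
  ... | n , len-M = subst (2 ≤_) (sym (trans (len-∷-nonzero 1# (nonzeroProduct-nonzero Fs)) (cong suc len-M)))
                      (s≤s (s≤s z≤n))

  euclid-fresh : ∀ Fs {P} → P ∣ˡ euclid Fs → 2 ≤ len P → trim P ∉ Fs
  euclid-fresh Fs {P} P∣N 2≤P trim-P∈ = ∤-const {P} 2≤P (λ 1≡0 → 0≢1 (sym 1≡0)) P∣1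
    where
      M = nonzeroProduct Fs
      P∣M : P ∣ˡ M
      P∣M = ∣ˡ-respˡ-≈ (trim≈ P)
              (nonzeroProduct-∣ Fs trim-P∈ λ trim-P≈0 →
                 nonconstant⇒nonzero {P} 2≤P (≈-trans (≈-sym (trim≈ P)) trim-P≈0))
      P∣TM : P ∣ˡ shift M
      P∣TM with P∣M
      ... | h , Ph≈M = shift h , ≈-trans (*ₚ-shift P h) (shift-cong Ph≈M)
      P∣1 : P ∣ˡ 1ₚ
      P∣1 = ∣ˡ-respʳ-≈ (≈-trans (+ₚ-cong (∷-as-sum 1# M) (≈-refl { -ₚ shift M}))
                                (PolyGroup.//-rightDividesʳ (shift M) 1ₚ))
              (∣-+ P∣N (∣-neg P∣TM))

  euclid-field-modulus : ∀ Fs → ∃ λ P → FieldModulus P × 2 ≤ len P × trim P ∉ Fs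
  euclid-field-modulus Fs with field-modulus-divisor (euclid Fs) (euclid-len Fs)
  ... | P , P∣N , 2≤P , field-P = P , field-P , 2≤P , euclid-fresh Fs P∣N 2≤P

theorem1p5 : (q : ℕ) (K : FiniteField q) (L : List (List (Fin q) × List (Fin q))) →
    let open PolyOver K in
    ∃₂ λ (F G : Poly) →
    Normal F × F ≢ [] × Normal G × G ≢ [] × (F , G) ∉ L ×
    ∃ λ (m : ℕ) → PhiIs F m × SigmaNmIs G m
theorem1p5 q K L =
  let open PolyOver K
      open Proof K
      (P , field-P , 2≤P , fresh) = euclid-field-modulus (map proj₁ L)
      (k , φ[P] , σ[Tᵏ]) = phi-equals-sigma field-P 2≤P
  in trim P , T^ k , trim-normal P , (λ trim-P≡[] → nonconstant⇒nonzero {P} 2≤P (trim≡⇒≈ trim-P≡[])) ,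
     T^-normal k , T^-nonempty k , (λ PG∈L → fresh (∈-map⁺ proj₁ PG∈L)) ,
     q ^ suc k ∸ 1 , φ[P] , σ[Tᵏ]
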